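{- With probability at least $1-2^{ -\Omega(2^n)}$, a set $\mathbf{S}_{\mathrm{yes}}\sim\mathcal{S}_{\mathrm{yes}}$ is a sumset over $\mathbb{F}_2^{n+2}$, i.e. $\mathbf{S}_{\mathrm{yes}}=C+C$ for some $C\subseteq\mathbb{F}_2^{n+2}$.
   Context: For $A,B\subseteq\mathbb{F}_2^n$ define $\mathcal{S}(A,B)\subseteq\mathbb{F}_2^{n+2}$ by $\mathcal{S}(A,B)=\{x: x_1=x_2=0\}\sqcup\{(1,0,a):a\in A\}\sqcup\{(0,1,b):b\in B\}$, where $(b_1,b_2,v)$ denotes the concatenation of bits $b_1,b_2$ with $v\in\mathbb{F}_2^n$. To draw $\mathbf{S}_{\mathrm{yes}}\sim\mathcal{S}_{\mathrm{yes}}$: let $\mathbf{A}\subseteq\mathbb{F}_2^n$ include each element independently with probability $1/2$, let $\mathbf{s}$ be uniform in $\mathbb{F}_2^n$ (independent), let $\mathbf{B}=\mathbf{A}+\mathbf{s}=\{a+\mathbf{s}:a\in\mathbf{A}\}$, and set $\mathbf{S}_{\mathrm{yes}}=\mathcal{S}(\mathbf{A},\mathbf{B})\sqcup\{(1,1,\mathbf{s})\}$. For $C\subseteq\mathbb{F}_2^{n+2}$, $C+C=\{c+c':c,c'\in C\}$. -}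

module Defs where

open import Data.Bool using (Bool; true; false; _xor_)
open import Data.Nat using (ℕ; zero; suc; _^_; _*_; _+_)
open import Data.Fin using (Fin; _↑ˡ_; _↑ʳ_)
import Data.Fin as F
open import Data.Vec using (Vec; []; _∷_; zipWith; lookup)
open import Data.Product using (Σ; _×_; _,_; ∃; ∃-syntax)
open import Data.Unit using (⊤)
open import Data.Empty using (⊥)
open import Relation.Binary.PropositionalEquality using (_≡_)
open import Function.Bundles using (_⇔_)
open import Level using (0ℓ)
open import Relation.Unary using (Pred)

F2 : ℕ → Set
F2 n = Vec Bool n

_⊕_ : ∀ {n} → F2 n → F2 n → F2 n
_⊕_ = zipWith _xor_

SetF2 : ℕ → Set₁
SetF2 n = Pred (F2 n) 0ℓ

translate : ∀ {n} → SetF2 n → F2 n → SetF2 n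
translate A s b = ∃[ a ] (A a × b ≡ a ⊕ s)

𝒮 : ∀ {n} → SetF2 n → SetF2 n → SetF2 (suc (suc n))
𝒮 A B (false ∷ false ∷ v) = ⊤
𝒮 A B (true  ∷ false ∷ a) = A a
𝒮 A B (false ∷ true  ∷ b) = B b
𝒮 A B (true  ∷ true  ∷ v) = ⊥

Syes : ∀ {n} → SetF2 n → F2 n → SetF2 (suc (suc n))
Syes A s (true ∷ true ∷ v) = v ≡ s
Syes A s (b₁ ∷ b₂ ∷ v)     = 𝒮 A (translate A s) (b₁ ∷ b₂ ∷ v)

_+ₛ_ : ∀ {m} → SetF2 m → SetF2 m → SetF2 m
(C +ₛ D) x = ∃[ c ] ∃[ d ] (C c × D d × x ≡ c ⊕ d)

IsSumset : ∀ {m} → SetF2 m → Set₁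
IsSumset {m} S = Σ (SetF2 m) λ C → ∀ x → S x ⇔ (C +ₛ C) x

index : ∀ {n} → F2 n → Fin (2 ^ n)
index [] = F.zero
index {suc n} (false ∷ v) = index v ↑ˡ (2 ^ n + 0)
index {suc n} (true  ∷ v) = (2 ^ n) ↑ʳ (index v ↑ˡ 0)

-- Sample space of the random choice (A, s): A is encoded by its indicator
-- vector of length 2^n (uniform = each element independently with prob 1/2),
-- s ∈ F_2^n uniform. All outcomes are equally likely.
Sample : ℕ → Set
Sample n = Vec Bool (2 ^ n) × F2 n

total : ℕ → ℕ
total n = 2 ^ (2 ^ n) * 2 ^ n

decodeSet : ∀ {n} → Vec Bool (2 ^ n) → SetF2 n
decodeSet A a = lookup A (index a) ≡ true

SyesOf : ∀ {n} → Sample n → SetF2 (suc (suc n))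
SyesOf (A , s) = Syes (decodeSet A) s

module Submission where

-- If A + A = F₂ⁿ then S_yes = C + C for C = {(0,0,a) : a ∈ A} ∪ {(1,0,0), (0,1,s)}.
-- A set A with d ∉ A + A contains at most one point of each pair {a, a + d}; for d ≠ 0
-- these 2ⁿ⁻¹ pairs partition F₂ⁿ, so there are at most 3^(2ⁿ⁻¹) such A. A union bound over
-- the 2ⁿ values of d shows that A + A ≠ F₂ⁿ for at most a fraction 2ⁿ (3/4)^(2ⁿ⁻¹) of all A,
-- which is below 2^(−2ⁿ/10) once n ≥ 6.

open import Defs
open import Algebra.Properties.CommutativeSemigroup using (interchange)
open import Data.Bool using (Bool; true; false; not; _∧_; _xor_; _≟_)
open import Data.Bool.ListAction using (any)
open import Data.Bool.Properties using (xor-comm; xor-identityˡ; xor-identityʳ; ∨-conicalˡ; ∨-conicalʳ)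
open import Data.Empty using (⊥)
open import Data.Fin using (Fin)
import Data.Fin as Fin
open import Data.List using (List; []; _∷_; _++_; map; length; cartesianProduct; cartesianProductWith; filter; lookup)
open import Data.List.Properties using (length-++; length-map)
open import Data.List.Membership.Propositional using (_∈_)
open import Data.List.Membership.Propositional.Properties
  using (∈-cartesianProductWith⁺; ∈-cartesianProduct⁻; ∈-lookup; ∈-filter⁻; ∈-map⁻)
import Data.List.Relation.Unary.All as All
import Data.List.Relation.Unary.AllPairs as AllPairs
open import Data.List.Relation.Unary.Any using (here; there)
open import Data.List.Relation.Unary.Unique.Propositional using (Unique)
import Data.List.Relation.Unary.Unique.Propositional.Properties as Unique
open import Data.Nat using (ℕ; zero; suc; _+_; _*_; _^_; _≤_; _∸_; z≤n; s≤s)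
open import Data.Nat.Properties
  using (+-assoc; +-suc; +-identityʳ; +-mono-≤; +-commutativeSemigroup; *-comm; *-zeroʳ; *-identityˡ;
         *-distribˡ-+; *-distribʳ-+; *-mono-≤; *-monoˡ-≤; *-monoʳ-≤; ^-distribˡ-+-*; ^-*-assoc; ^-monoˡ-≤;
         ^-monoʳ-≤; m+n∸m≡n; m≤m+n; m≤n⇒∃[o]m+o≡n; ≤-trans; ≤-reflexive; module ≤-Reasoning)
open import Data.Nat.Solver using (module +-*-Solver)
open import Data.Product using (Σ; _×_; _,_; ∃-syntax; proj₁; proj₂; swap)
open import Data.Unit using (tt)
open import Data.Vec as Vec using (Vec; []; _∷_; replicate)
open import Data.Vec.Properties
  using (zipWith-identityˡ; zipWith-identityʳ; lookup-++ˡ; lookup-++ʳ; ++-injective; ++-injectiveˡ; ∷-injective)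
open import Function.Bundles using (mk⇔)
open import Function.Definitions using (Injective)
open import Relation.Binary.PropositionalEquality
open import Relation.Nullary using (contradiction)

private variable A B C D : Set

-- Sumsets in F₂ⁿ⁺²

𝟎 : ∀ {n} → F2 n
𝟎 = replicate _ false

⊕-identityˡ : ∀ {n} (v : F2 n) → 𝟎 ⊕ v ≡ v
⊕-identityˡ = zipWith-identityˡ xor-identityˡ

⊕-identityʳ : ∀ {n} (v : F2 n) → v ⊕ 𝟎 ≡ v
⊕-identityʳ = zipWith-identityʳ xor-identityʳ

⊕-comm : ∀ {n} (u v : F2 n) → u ⊕ v ≡ v ⊕ u
⊕-comm []      []      = refl
⊕-comm (x ∷ u) (y ∷ v) = cong₂ _∷_ (xor-comm x y) (⊕-comm u v)

module _ {n} (A : SetF2 n) (s : F2 n) where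

  syesSummand : SetF2 (suc (suc n))
  syesSummand (false ∷ false ∷ a) = A a
  syesSummand (true  ∷ false ∷ v) = v ≡ 𝟎
  syesSummand (false ∷ true  ∷ v) = v ≡ s
  syesSummand (true  ∷ true  ∷ _) = ⊥

  syesSummand-+-⊆ : ∀ c d → syesSummand c → syesSummand d → Syes A s (c ⊕ d)
  syesSummand-+-⊆ (false ∷ false ∷ _) (false ∷ false ∷ _) _    _    = tt
  syesSummand-+-⊆ (false ∷ false ∷ a) (true  ∷ false ∷ _) a∈A  refl = subst A (sym (⊕-identityʳ a)) a∈A
  syesSummand-+-⊆ (false ∷ false ∷ a) (false ∷ true  ∷ _) a∈A  refl = a , a∈A , refl
  syesSummand-+-⊆ (true  ∷ false ∷ _) (false ∷ false ∷ b) refl b∈A  = subst A (sym (⊕-identityˡ b)) b∈A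
  syesSummand-+-⊆ (true  ∷ false ∷ _) (true  ∷ false ∷ _) _    _    = tt
  syesSummand-+-⊆ (true  ∷ false ∷ _) (false ∷ true  ∷ _) refl refl = ⊕-identityˡ s
  syesSummand-+-⊆ (false ∷ true  ∷ _) (false ∷ false ∷ b) refl b∈A  = b , b∈A , ⊕-comm s b
  syesSummand-+-⊆ (false ∷ true  ∷ _) (true  ∷ false ∷ _) refl refl = ⊕-identityʳ s
  syesSummand-+-⊆ (false ∷ true  ∷ _) (false ∷ true  ∷ _) _    _    = tt
  syesSummand-+-⊆ (true  ∷ true  ∷ _) _                   ()   _
  syesSummand-+-⊆ (false ∷ false ∷ _) (true  ∷ true  ∷ _) _    ()
  syesSummand-+-⊆ (true  ∷ false ∷ _) (true  ∷ true  ∷ _) _    ()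
  syesSummand-+-⊆ (false ∷ true  ∷ _) (true  ∷ true  ∷ _) _    ()

  Syes-⊆-syesSummand-+ : (∀ v → (A +ₛ A) v) → ∀ x → Syes A s x → (syesSummand +ₛ syesSummand) x
  Syes-⊆-syesSummand-+ A+A-full (false ∷ false ∷ v) _ with A+A-full v
  ... | a , b , a∈A , b∈A , refl = (false ∷ false ∷ a) , (false ∷ false ∷ b) , a∈A , b∈A , refl
  Syes-⊆-syesSummand-+ _ (true ∷ false ∷ a) a∈A =
    (false ∷ false ∷ a) , (true ∷ false ∷ 𝟎) , a∈A , refl , cong (λ w → true ∷ false ∷ w) (sym (⊕-identityʳ a))
  Syes-⊆-syesSummand-+ _ (false ∷ true ∷ _) (a , a∈A , refl) =
    (false ∷ false ∷ a) , (false ∷ true ∷ s) , a∈A , refl , refl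
  Syes-⊆-syesSummand-+ _ (true ∷ true ∷ _) refl =
    (true ∷ false ∷ 𝟎) , (false ∷ true ∷ s) , refl , refl , cong (λ w → true ∷ true ∷ w) (sym (⊕-identityˡ s))

Syes-isSumset : ∀ {n} {A : SetF2 n} (s : F2 n) → (∀ v → (A +ₛ A) v) → IsSumset (Syes A s)
Syes-isSumset {A = A} s A+A-full = syesSummand A s , λ x → mk⇔
  (Syes-⊆-syesSummand-+ A s A+A-full x)
  (λ { (c , d , c∈C , d∈C , refl) → syesSummand-+-⊆ A s c d c∈C d∈C })

-- Sums over lists

∑ : List A → (A → ℕ) → ℕ
∑ []       f = 0
∑ (x ∷ xs) f = f x + ∑ xs f

syntax ∑ xs (λ x → e) = ∑[ x ← xs ] e

∑-cong : ∀ (xs : List A) {f g : A → ℕ} → (∀ x → f x ≡ g x) → ∑ xs f ≡ ∑ xs g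
∑-cong []       f≗g = refl
∑-cong (x ∷ xs) f≗g = cong₂ _+_ (f≗g x) (∑-cong xs f≗g)

∑-mono-≤ : ∀ (xs : List A) {f g : A → ℕ} → (∀ x → f x ≤ g x) → ∑ xs f ≤ ∑ xs g
∑-mono-≤ []       f≤g = z≤n
∑-mono-≤ (x ∷ xs) f≤g = +-mono-≤ (f≤g x) (∑-mono-≤ xs f≤g)

∑-const : ∀ (xs : List A) c → ∑[ _ ← xs ] c ≡ length xs * c
∑-const []       c = refl
∑-const (x ∷ xs) c = cong (c +_) (∑-const xs c)

∑-zero : ∀ (xs : List A) → ∑[ _ ← xs ] 0 ≡ 0
∑-zero xs = trans (∑-const xs 0) (*-zeroʳ (length xs))

∑-+ : ∀ (xs : List A) f g → ∑[ x ← xs ] (f x + g x) ≡ ∑ xs f + ∑ xs g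
∑-+ []       f g = refl
∑-+ (x ∷ xs) f g = trans (cong (f x + g x +_) (∑-+ xs f g))
  (interchange +-commutativeSemigroup (f x) (g x) (∑ xs f) (∑ xs g))

∑-*ˡ : ∀ (xs : List A) c f → ∑[ x ← xs ] (c * f x) ≡ c * ∑ xs f
∑-*ˡ []       c f = sym (*-zeroʳ c)
∑-*ˡ (x ∷ xs) c f = trans (cong (c * f x +_) (∑-*ˡ xs c f)) (sym (*-distribˡ-+ c (f x) (∑ xs f)))

∑-*ʳ : ∀ (xs : List A) c f → ∑[ x ← xs ] (f x * c) ≡ ∑ xs f * c
∑-*ʳ xs c f = trans (∑-cong xs (λ x → *-comm (f x) c)) (trans (∑-*ˡ xs c f) (*-comm c (∑ xs f)))

∑-++ : ∀ (xs ys : List A) f → ∑ (xs ++ ys) f ≡ ∑ xs f + ∑ ys f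
∑-++ []       ys f = refl
∑-++ (x ∷ xs) ys f = trans (cong (f x +_) (∑-++ xs ys f)) (sym (+-assoc (f x) _ _))

∑-map : ∀ (g : A → B) xs f → ∑ (map g xs) f ≡ ∑[ x ← xs ] f (g x)
∑-map g []       f = refl
∑-map g (x ∷ xs) f = cong (f (g x) +_) (∑-map g xs f)

∑-comm : ∀ (xs : List A) (ys : List B) (f : A → B → ℕ) →
  ∑[ x ← xs ] ∑[ y ← ys ] f x y ≡ ∑[ y ← ys ] ∑[ x ← xs ] f x y
∑-comm []       ys f = sym (∑-zero ys)
∑-comm (x ∷ xs) ys f = trans (cong (∑ ys (f x) +_) (∑-comm xs ys f)) (sym (∑-+ ys (f x) _))

∑-cartesianProduct : ∀ (xs : List A) (ys : List B) f →
  ∑ (cartesianProduct xs ys) f ≡ ∑[ x ← xs ] ∑[ y ← ys ] f (x , y)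
∑-cartesianProduct []       ys f = refl
∑-cartesianProduct (x ∷ xs) ys f = begin
  ∑ (map (x ,_) ys ++ cartesianProduct xs ys) f     ≡⟨ ∑-++ (map (x ,_) ys) _ f ⟩
  ∑ (map (x ,_) ys) f + ∑ (cartesianProduct xs ys) f ≡⟨ cong₂ _+_ (∑-map (x ,_) ys f) (∑-cartesianProduct xs ys f) ⟩
  ∑[ y ← ys ] f (x , y) + ∑[ x ← xs ] ∑[ y ← ys ] f (x , y) ∎
  where open ≡-Reasoning

∑-swap : ∀ (xs : List A) (ys : List B) f →
  ∑[ p ← cartesianProduct xs ys ] f (swap p) ≡ ∑ (cartesianProduct ys xs) f
∑-swap xs ys f = begin
  ∑[ p ← cartesianProduct xs ys ] f (swap p) ≡⟨ ∑-cartesianProduct xs ys _ ⟩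
  ∑[ x ← xs ] ∑[ y ← ys ] f (y , x)          ≡⟨ ∑-comm xs ys _ ⟩
  ∑[ y ← ys ] ∑[ x ← xs ] f (y , x)          ≡⟨ ∑-cartesianProduct ys xs f ⟨
  ∑ (cartesianProduct ys xs) f ∎
  where open ≡-Reasoning

∑-product : ∀ (xs : List A) (ys : List B) f g →
  ∑[ p ← cartesianProduct xs ys ] (f (proj₁ p) * g (proj₂ p)) ≡ ∑ xs f * ∑ ys g
∑-product xs ys f g = begin
  ∑[ p ← cartesianProduct xs ys ] (f (proj₁ p) * g (proj₂ p)) ≡⟨ ∑-cartesianProduct xs ys _ ⟩
  ∑[ x ← xs ] ∑[ y ← ys ] (f x * g y)                        ≡⟨ ∑-cong xs (λ x → ∑-*ˡ ys (f x) g) ⟩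
  ∑[ x ← xs ] (f x * ∑ ys g)                                  ≡⟨ ∑-*ʳ xs (∑ ys g) f ⟩
  ∑ xs f * ∑ ys g ∎
  where open ≡-Reasoning

transpose : (A × B) × (C × D) → (A × C) × (B × D)
transpose ((a , b) , (c , d)) = (a , c) , (b , d)

∑-transpose : ∀ (xs : List A) (ys : List B) (zs : List C) (ws : List D) f →
  ∑ (cartesianProduct (cartesianProduct xs ys) (cartesianProduct zs ws)) f ≡
  ∑[ q ← cartesianProduct (cartesianProduct xs zs) (cartesianProduct ys ws) ] f (transpose q)
∑-transpose xs ys zs ws f = begin
  ∑ (cartesianProduct (cartesianProduct xs ys) (cartesianProduct zs ws)) f
    ≡⟨ ∑-cartesianProduct (cartesianProduct xs ys) _ f ⟩
  ∑[ p ← cartesianProduct xs ys ] ∑[ r ← cartesianProduct zs ws ] f (p , r)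
    ≡⟨ ∑-cartesianProduct xs ys _ ⟩
  ∑[ x ← xs ] ∑[ y ← ys ] ∑[ r ← cartesianProduct zs ws ] f ((x , y) , r)
    ≡⟨ ∑-cong xs (λ x → ∑-cong ys (λ y → ∑-cartesianProduct zs ws _)) ⟩
  ∑[ x ← xs ] ∑[ y ← ys ] ∑[ z ← zs ] ∑[ w ← ws ] f ((x , y) , (z , w))
    ≡⟨ ∑-cong xs (λ x → ∑-comm ys zs _) ⟩
  ∑[ x ← xs ] ∑[ z ← zs ] ∑[ y ← ys ] ∑[ w ← ws ] f ((x , y) , (z , w))
    ≡⟨ ∑-cong xs (λ x → ∑-cong zs (λ z → ∑-cartesianProduct ys ws _)) ⟨
  ∑[ x ← xs ] ∑[ z ← zs ] ∑[ r ← cartesianProduct ys ws ] f (transpose ((x , z) , r))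
    ≡⟨ ∑-cartesianProduct xs zs _ ⟨
  ∑[ p ← cartesianProduct xs zs ] ∑[ r ← cartesianProduct ys ws ] f (transpose (p , r))
    ≡⟨ ∑-cartesianProduct (cartesianProduct xs zs) _ _ ⟨
  ∑[ q ← cartesianProduct (cartesianProduct xs zs) (cartesianProduct ys ws) ] f (transpose q) ∎
  where open ≡-Reasoning

∑-swapʳ : ∀ (xs : List A) (ys : List B) f →
  ∑[ p ← cartesianProduct xs (cartesianProduct ys ys) ] f (proj₁ p , swap (proj₂ p)) ≡
  ∑ (cartesianProduct xs (cartesianProduct ys ys)) f
∑-swapʳ xs ys f = begin
  ∑[ p ← cartesianProduct xs (cartesianProduct ys ys) ] f (proj₁ p , swap (proj₂ p))
    ≡⟨ ∑-cartesianProduct xs _ _ ⟩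
  ∑[ x ← xs ] ∑[ y ← cartesianProduct ys ys ] f (x , swap y)
    ≡⟨ ∑-cong xs (λ x → ∑-swap ys ys (λ y → f (x , y))) ⟩
  ∑[ x ← xs ] ∑[ y ← cartesianProduct ys ys ] f (x , y)
    ≡⟨ ∑-cartesianProduct xs _ f ⟨
  ∑ (cartesianProduct xs (cartesianProduct ys ys)) f ∎
  where open ≡-Reasoning

length-cartesianProductWith : ∀ (f : A → B → C) xs ys →
  length (cartesianProductWith f xs ys) ≡ length xs * length ys
length-cartesianProductWith f []       ys = refl
length-cartesianProductWith f (x ∷ xs) ys =
  trans (length-++ (map (f x) ys)) (cong₂ _+_ (length-map (f x) ys) (length-cartesianProductWith f xs ys))

lookup-injective : ∀ {xs : List A} → Unique xs → Injective _≡_ _≡_ (lookup xs)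
lookup-injective (_    AllPairs.∷ _)      {Fin.zero}  {Fin.zero}  _  = refl
lookup-injective (x∉xs AllPairs.∷ _)      {Fin.zero}  {Fin.suc j} eq = contradiction eq (All.lookup x∉xs (∈-lookup j))
lookup-injective (x∉xs AllPairs.∷ _)      {Fin.suc i} {Fin.zero}  eq = contradiction (sym eq) (All.lookup x∉xs (∈-lookup i))
lookup-injective (_    AllPairs.∷ unique) {Fin.suc i} {Fin.suc j} eq = cong Fin.suc (lookup-injective unique eq)

ind : Bool → ℕ
ind true  = 1
ind false = 0

ind-∧ : ∀ a b → ind (a ∧ b) ≡ ind a * ind b
ind-∧ false b = refl
ind-∧ true  b = sym (+-identityʳ (ind b))

ind-any-≤ : ∀ (p : A → Bool) xs → ind (any p xs) ≤ ∑[ x ← xs ] ind (p x)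
ind-any-≤ p []       = z≤n
ind-any-≤ p (x ∷ xs) with p x
... | true  = s≤s z≤n
... | false = ind-any-≤ p xs

any-≡false : ∀ (p : A → Bool) {xs x} → any p xs ≡ false → x ∈ xs → p x ≡ false
any-≡false p {y ∷ ys} none (here refl) = ∨-conicalˡ (p y) (any p ys) none
any-≡false p {y ∷ ys} none (there x∈) = any-≡false p (∨-conicalʳ (p y) (any p ys) none) x∈

length-filter-≡false : ∀ (p : A → Bool) xs →
  length (filter (λ x → p x ≟ false) xs) + ∑[ x ← xs ] ind (p x) ≡ length xs
length-filter-≡false p []       = refl
length-filter-≡false p (x ∷ xs) with p x
... | false = cong suc (length-filter-≡false p xs)
... | true  = trans (+-suc _ _) (cong suc (length-filter-≡false p xs))

^-2^-suc : ∀ b n → b ^ 2 ^ suc n ≡ b ^ 2 ^ n * b ^ 2 ^ n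
^-2^-suc b n = trans (^-distribˡ-+-* b (2 ^ n) (2 ^ n + 0)) (cong (λ m → b ^ 2 ^ n * b ^ m) (+-identityʳ (2 ^ n)))

-- Enumerations of F₂ⁿ and of its subsets

bits : List Bool
bits = false ∷ true ∷ []

bits-unique : Unique bits
bits-unique = ((λ ()) All.∷ All.[]) AllPairs.∷ (All.[] AllPairs.∷ AllPairs.[])

vectors : ∀ n → List (F2 n)
vectors zero    = [] ∷ []
vectors (suc n) = cartesianProductWith _∷_ bits (vectors n)

length-vectors : ∀ n → length (vectors n) ≡ 2 ^ n
length-vectors zero    = refl
length-vectors (suc n) =
  trans (length-cartesianProductWith _∷_ bits (vectors n)) (cong (2 *_) (length-vectors n))

∈-vectors : ∀ {n} (v : F2 n) → v ∈ vectors n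
∈-vectors []          = here refl
∈-vectors (false ∷ v) = ∈-cartesianProductWith⁺ _∷_ {xs = bits} (here refl) (∈-vectors v)
∈-vectors (true ∷ v)  = ∈-cartesianProductWith⁺ _∷_ {xs = bits} (there (here refl)) (∈-vectors v)

vectors-unique : ∀ n → Unique (vectors n)
vectors-unique zero    = All.[] AllPairs.∷ AllPairs.[]
vectors-unique (suc n) = Unique.cartesianProductWith⁺ _∷_ ∷-injective bits-unique (vectors-unique n)

-- A subset of F₂ⁿ is handled as its truth table, a complete binary tree branching on the
-- first coordinate; toVec flattens it to the indicator vector read by decodeSet.
Tree : ℕ → Set
Tree zero    = Bool
Tree (suc n) = Tree n × Tree n

trees : ∀ n → List (Tree n)
trees zero    = bits
trees (suc n) = cartesianProduct (trees n) (trees n)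

trees-unique : ∀ n → Unique (trees n)
trees-unique zero    = bits-unique
trees-unique (suc n) = Unique.cartesianProduct⁺ (trees-unique n) (trees-unique n)

length-trees : ∀ n → length (trees n) ≡ 2 ^ 2 ^ n
length-trees zero    = refl
length-trees (suc n) = begin
  length (cartesianProduct (trees n) (trees n)) ≡⟨ length-cartesianProductWith _,_ (trees n) (trees n) ⟩
  length (trees n) * length (trees n)           ≡⟨ cong₂ _*_ (length-trees n) (length-trees n) ⟩
  2 ^ 2 ^ n * 2 ^ 2 ^ n                         ≡⟨ ^-2^-suc 2 n ⟨
  2 ^ 2 ^ suc n ∎
  where open ≡-Reasoning

member : ∀ {n} → Tree n → F2 n → Bool
member {zero}  b       []          = b
member {suc n} (X , _) (false ∷ a) = member X a
member {suc n} (_ , Y) (true ∷ a)  = member Y a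

⟦_⟧ : ∀ {n} → Tree n → SetF2 n
⟦ X ⟧ a = member X a ≡ true

toVec : ∀ {n} → Tree n → Vec Bool (2 ^ n)
toVec {zero}  b       = b ∷ []
toVec {suc n} (X , Y) = toVec X Vec.++ (toVec Y Vec.++ [])

lookup-toVec : ∀ {n} (X : Tree n) (a : F2 n) → Vec.lookup (toVec X) (index a) ≡ member X a
lookup-toVec {zero}  b       []          = refl
lookup-toVec {suc n} (X , Y) (false ∷ a) = trans (lookup-++ˡ (toVec X) _ (index a)) (lookup-toVec X a)
lookup-toVec {suc n} (X , Y) (true ∷ a)  =
  trans (lookup-++ʳ (toVec X) _ _) (trans (lookup-++ˡ (toVec Y) [] (index a)) (lookup-toVec Y a))

toVec-injective : ∀ {n} → Injective _≡_ _≡_ (toVec {n})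
toVec-injective {zero}  refl = refl
toVec-injective {suc n} {X , Y} {X′ , Y′} eq with ++-injective (toVec X) (toVec X′) eq
... | X≡X′ , Y≡Y′ = cong₂ _,_ (toVec-injective X≡X′) (toVec-injective (++-injectiveˡ (toVec Y) (toVec Y′) Y≡Y′))

-- Sets A with A + A ≠ F₂ⁿ

notInSum : ∀ {n} → F2 n → Tree n × Tree n → Bool
notInSum {zero}  []          (X , Y)                 = not (X ∧ Y)
notInSum {suc n} (false ∷ d) ((X₀ , X₁) , (Y₀ , Y₁)) = notInSum d (X₀ , Y₀) ∧ notInSum d (X₁ , Y₁)
notInSum {suc n} (true ∷ d)  ((X₀ , X₁) , (Y₀ , Y₁)) = notInSum d (X₀ , Y₁) ∧ notInSum d (X₁ , Y₀)

-- When d starts with 1, a and a + d lie in different halves of X, so each pair {a, a + d}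
-- is tested only once.
notInSelfSum : ∀ {n} → F2 n → Tree n → Bool
notInSelfSum {zero}  []          X         = not X
notInSelfSum {suc n} (false ∷ d) (X₀ , X₁) = notInSelfSum d X₀ ∧ notInSelfSum d X₁
notInSelfSum {suc n} (true ∷ d)  X         = notInSum d X

+ₛ-∷ : ∀ {n} (P Q : SetF2 (suc n)) b c {d} →
  ((λ a → P (b ∷ a)) +ₛ (λ a → Q (c ∷ a))) d → (P +ₛ Q) ((b xor c) ∷ d)
+ₛ-∷ P Q b c (a , a′ , a∈P , a′∈Q , d≡) = b ∷ a , c ∷ a′ , a∈P , a′∈Q , cong ((b xor c) ∷_) d≡

notInSum-false : ∀ {n} (d : F2 n) X Y → notInSum d (X , Y) ≡ false → (⟦ X ⟧ +ₛ ⟦ Y ⟧) d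
notInSum-false {zero}  []          true  true  _  = [] , [] , refl , refl , refl
notInSum-false {zero}  []          false _     ()
notInSum-false {zero}  []          true  false ()
notInSum-false {suc n} (false ∷ d) (X₀ , X₁) (Y₀ , Y₁) eq with notInSum d (X₀ , Y₀) in eq₀
... | false = +ₛ-∷ ⟦ X₀ , X₁ ⟧ ⟦ Y₀ , Y₁ ⟧ false false (notInSum-false d X₀ Y₀ eq₀)
... | true  = +ₛ-∷ ⟦ X₀ , X₁ ⟧ ⟦ Y₀ , Y₁ ⟧ true  true  (notInSum-false d X₁ Y₁ eq)
notInSum-false {suc n} (true ∷ d)  (X₀ , X₁) (Y₀ , Y₁) eq with notInSum d (X₀ , Y₁) in eq₀
... | false = +ₛ-∷ ⟦ X₀ , X₁ ⟧ ⟦ Y₀ , Y₁ ⟧ false true  (notInSum-false d X₀ Y₁ eq₀)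
... | true  = +ₛ-∷ ⟦ X₀ , X₁ ⟧ ⟦ Y₀ , Y₁ ⟧ true  false (notInSum-false d X₁ Y₀ eq)

notInSelfSum-false : ∀ {n} (d : F2 n) X → notInSelfSum d X ≡ false → (⟦ X ⟧ +ₛ ⟦ X ⟧) d
notInSelfSum-false {zero}  []          true      _  = [] , [] , refl , refl , refl
notInSelfSum-false {zero}  []          false     ()
notInSelfSum-false {suc n} (false ∷ d) (X₀ , X₁) eq with notInSelfSum d X₀ in eq₀
... | false = +ₛ-∷ ⟦ X₀ , X₁ ⟧ ⟦ X₀ , X₁ ⟧ false false (notInSelfSum-false d X₀ eq₀)
... | true  = +ₛ-∷ ⟦ X₀ , X₁ ⟧ ⟦ X₀ , X₁ ⟧ true  true  (notInSelfSum-false d X₁ eq)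
notInSelfSum-false {suc n} (true ∷ d)  (X₀ , X₁) eq =
  +ₛ-∷ ⟦ X₀ , X₁ ⟧ ⟦ X₀ , X₁ ⟧ false true (notInSum-false d X₀ X₁ eq)

#notInSum : ∀ {n} → F2 n → ℕ
#notInSum {n} d = ∑[ p ← trees (suc n) ] ind (notInSum d p)

#notInSum-∷ : ∀ {n} b (d : F2 n) → #notInSum (b ∷ d) ≡ #notInSum d * #notInSum d
#notInSum-∷ {n} false d = begin
  ∑[ p ← cartesianProduct T T ] ind (notInSum (false ∷ d) p)
    ≡⟨ ∑-transpose E E E E _ ⟩
  ∑[ q ← cartesianProduct T T ] ind (notInSum d (proj₁ q) ∧ notInSum d (proj₂ q))
    ≡⟨ ∑-cong (cartesianProduct T T) (λ q → ind-∧ (notInSum d (proj₁ q)) _) ⟩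
  ∑[ q ← cartesianProduct T T ] (ind (notInSum d (proj₁ q)) * ind (notInSum d (proj₂ q)))
    ≡⟨ ∑-product T T _ _ ⟩
  #notInSum d * #notInSum d ∎
  where
  open ≡-Reasoning
  E = trees n
  T = trees (suc n)
#notInSum-∷ {n} true d =
  trans (∑-swapʳ (trees (suc n)) (trees n) (λ p → ind (notInSum (false ∷ d) p))) (#notInSum-∷ false d)

-- Translation by d is a bijection, so this counts the disjoint pairs (X, Y + d): 3 choices per point.
#notInSum≡3^2^n : ∀ {n} (d : F2 n) → #notInSum d ≡ 3 ^ 2 ^ n
#notInSum≡3^2^n {zero}  []      = refl
#notInSum≡3^2^n {suc n} (b ∷ d) = begin
  #notInSum (b ∷ d)         ≡⟨ #notInSum-∷ b d ⟩
  #notInSum d * #notInSum d ≡⟨ cong₂ _*_ (#notInSum≡3^2^n d) (#notInSum≡3^2^n d) ⟩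
  3 ^ 2 ^ n * 3 ^ 2 ^ n     ≡⟨ ^-2^-suc 3 n ⟨
  3 ^ 2 ^ suc n ∎
  where open ≡-Reasoning

#notInSelfSum : ∀ {n} → F2 n → ℕ
#notInSelfSum {n} d = ∑[ X ← trees n ] ind (notInSelfSum d X)

#notInSelfSum≤3^2^n : ∀ {n} (d : F2 (suc n)) → #notInSelfSum d ≤ 3 ^ 2 ^ n
#notInSelfSum≤3^2^n {zero}  (false ∷ []) = s≤s z≤n
#notInSelfSum≤3^2^n         (true ∷ d)   = ≤-reflexive (#notInSum≡3^2^n d)
#notInSelfSum≤3^2^n {suc n} (false ∷ d)  = begin
  ∑[ X ← cartesianProduct T T ] ind (notInSelfSum d (proj₁ X) ∧ notInSelfSum d (proj₂ X))
    ≡⟨ ∑-cong (cartesianProduct T T) (λ X → ind-∧ (notInSelfSum d (proj₁ X)) _) ⟩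
  ∑[ X ← cartesianProduct T T ] (ind (notInSelfSum d (proj₁ X)) * ind (notInSelfSum d (proj₂ X)))
    ≡⟨ ∑-product T T _ _ ⟩
  #notInSelfSum d * #notInSelfSum d
    ≤⟨ *-mono-≤ (#notInSelfSum≤3^2^n d) (#notInSelfSum≤3^2^n d) ⟩
  3 ^ 2 ^ n * 3 ^ 2 ^ n
    ≡⟨ ^-2^-suc 3 n ⟨
  3 ^ 2 ^ suc n ∎
  where
  open ≤-Reasoning
  T = trees (suc n)

hasGap : ∀ {n} → Tree n → Bool
hasGap {n} X = any (λ d → notInSelfSum d X) (vectors n)

gapless : ∀ n → List (Tree n)
gapless n = filter (λ X → hasGap X ≟ false) (trees n)

samples : ∀ n → List (Sample n)
samples n = cartesianProduct (map toVec (gapless n)) (vectors n)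

samples-unique : ∀ n → Unique (samples n)
samples-unique n = Unique.cartesianProduct⁺
  (Unique.map⁺ toVec-injective (Unique.filter⁺ (λ X → hasGap X ≟ false) (trees-unique n)))
  (vectors-unique n)

noGap⇒+ₛ-full : ∀ {n} (X : Tree n) → hasGap X ≡ false → ∀ v → (decodeSet (toVec X) +ₛ decodeSet (toVec X)) v
noGap⇒+ₛ-full X noGap v with notInSelfSum-false v X (any-≡false (λ d → notInSelfSum d X) noGap (∈-vectors v))
... | a , b , a∈X , b∈X , v≡ = a , b , trans (lookup-toVec X a) a∈X , trans (lookup-toVec X b) b∈X , v≡

∈-samples⇒isSumset : ∀ {n} {p : Sample n} → p ∈ samples n → IsSumset (SyesOf p)
∈-samples⇒isSumset {n} {_ , s} p∈ with ∈-map⁻ (toVec {n}) {xs = gapless n} (proj₁ (∈-cartesianProduct⁻ _ (vectors n) p∈))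
... | X , X∈ , refl = Syes-isSumset s (noGap⇒+ₛ-full X (proj₂ (∈-filter⁻ (λ X → hasGap X ≟ false) {xs = trees n} X∈)))

length-samples : ∀ n → length (samples n) ≡ length (gapless n) * 2 ^ n
length-samples n = trans (length-cartesianProductWith _,_ (map toVec (gapless n)) (vectors n))
  (cong₂ _*_ (length-map toVec (gapless n)) (length-vectors n))

#hasGap : ℕ → ℕ
#hasGap n = ∑[ X ← trees n ] ind (hasGap X)

length-gapless+#hasGap : ∀ n → length (gapless n) + #hasGap n ≡ 2 ^ 2 ^ n
length-gapless+#hasGap n = trans (length-filter-≡false hasGap (trees n)) (length-trees n)

#hasGap≤ : ∀ n → #hasGap (suc n) ≤ 2 ^ suc n * 3 ^ 2 ^ n
#hasGap≤ n = begin
  ∑[ X ← T ] ind (hasGap X)                    ≤⟨ ∑-mono-≤ T (λ X → ind-any-≤ (λ d → notInSelfSum d X) V) ⟩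
  ∑[ X ← T ] ∑[ d ← V ] ind (notInSelfSum d X) ≡⟨ ∑-comm T V _ ⟩
  ∑[ d ← V ] #notInSelfSum d                   ≤⟨ ∑-mono-≤ V #notInSelfSum≤3^2^n ⟩
  ∑[ d ← V ] (3 ^ 2 ^ n)                       ≡⟨ ∑-const V _ ⟩
  length V * 3 ^ 2 ^ n                         ≡⟨ cong (_* 3 ^ 2 ^ n) (length-vectors (suc n)) ⟩
  2 ^ suc n * 3 ^ 2 ^ n ∎
  where
  open ≤-Reasoning
  T = trees (suc n)
  V = vectors (suc n)

[m^n]^o≡[m^o]^n : ∀ m n o → (m ^ n) ^ o ≡ (m ^ o) ^ n
[m^n]^o≡[m^o]^n m n o = trans (^-*-assoc m n o) (trans (cong (m ^_) (*-comm n o)) (sym (^-*-assoc m o n)))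

[3^m]^10≤[2^m]^16 : ∀ m → (3 ^ m) ^ 10 ≤ (2 ^ m) ^ 16
[3^m]^10≤[2^m]^16 m = begin
  (3 ^ m) ^ 10 ≡⟨ [m^n]^o≡[m^o]^n 3 m 10 ⟩
  (3 ^ 10) ^ m ≤⟨ ^-monoˡ-≤ m (m≤m+n 59049 6487) ⟩
  (2 ^ 16) ^ m ≡⟨ [m^n]^o≡[m^o]^n 2 16 m ⟩
  (2 ^ m) ^ 16 ∎
  where open ≤-Reasoning

n*10≤2^n : ∀ {n} → 6 ≤ n → n * 10 ≤ 2 ^ n
n*10≤2^n 6≤n with m , refl ← m≤n⇒∃[o]m+o≡n 6≤n = go m
  where
  go : ∀ m → (6 + m) * 10 ≤ 2 ^ (6 + m)
  go zero    = m≤m+n 60 4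
  go (suc m) = +-mono-≤ (≤-trans (m≤m+n 10 _) (go m)) (≤-trans (go m) (m≤m+n _ 0))

-- Used with P = 2ⁿ, X² = 2^(2ⁿ), T = 3^(2ⁿ⁻¹) and U the number of sets A with A + A ≠ F₂ⁿ.
failure-ratio : ∀ U P X T → U ≤ P * T → T ^ 10 ≤ X ^ 16 → P ^ 10 ≤ X * X →
  (U * P) ^ 10 * (X * X) ≤ (X * X * P) ^ 10
failure-ratio U P X T U≤PT T¹⁰≤X¹⁶ P¹⁰≤X² = begin
  (U * P) ^ 10 * (X * X)                     ≤⟨ *-monoˡ-≤ (X * X) (^-monoˡ-≤ 10 (*-monoˡ-≤ P U≤PT)) ⟩
  (P * T * P) ^ 10 * (X * X)                 ≡⟨ solve 3 (λ P T X → (P :* T :* P) :^ 10 :* (X :* X) := T :^ 10 :* (P :^ 10 :* (P :^ 10 :* (X :* X)))) refl P T X ⟩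
  T ^ 10 * (P ^ 10 * (P ^ 10 * (X * X)))     ≤⟨ *-mono-≤ T¹⁰≤X¹⁶ (*-monoʳ-≤ (P ^ 10) (*-monoˡ-≤ (X * X) P¹⁰≤X²)) ⟩
  X ^ 16 * (P ^ 10 * (X * X * (X * X)))      ≡⟨ solve 2 (λ P X → X :^ 16 :* (P :^ 10 :* (X :* X :* (X :* X))) := (X :* X :* P) :^ 10) refl P X ⟩
  (X * X * P) ^ 10 ∎
  where
  open ≤-Reasoning
  open +-*-Solver

failure-bound : ∀ n → suc n * 10 ≤ 2 ^ suc n →
  (total (suc n) ∸ length (samples (suc n))) ^ 10 * 2 ^ (1 * 2 ^ suc n) ≤ total (suc n) ^ 10
failure-bound n N*10≤P = begin
  (total N ∸ length (samples N)) ^ 10 * 2 ^ (1 * 2 ^ N) ≡⟨ cong₂ (λ a b → a ^ 10 * 2 ^ b) failures (*-identityˡ P) ⟩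
  (U * P) ^ 10 * 2 ^ 2 ^ N                              ≡⟨ cong ((U * P) ^ 10 *_) 2^2^N≡X² ⟩
  (U * P) ^ 10 * (X * X)                                ≤⟨ failure-ratio U P X T (#hasGap≤ n) ([3^m]^10≤[2^m]^16 (2 ^ n)) P¹⁰≤X² ⟩
  (X * X * P) ^ 10                                      ≡⟨ cong (λ a → (a * P) ^ 10) 2^2^N≡X² ⟨
  total N ^ 10 ∎
  where
  open ≤-Reasoning
  N = suc n
  P = 2 ^ N
  X = 2 ^ 2 ^ n
  T = 3 ^ 2 ^ n
  G = length (gapless N)
  U = #hasGap N
  2^2^N≡X² : 2 ^ 2 ^ N ≡ X * X
  2^2^N≡X² = ^-2^-suc 2 n
  failures : total N ∸ length (samples N) ≡ U * P
  failures = begin-equality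
    total N ∸ length (samples N) ≡⟨ cong₂ (λ a b → a * P ∸ b) (length-gapless+#hasGap N) (sym (length-samples N)) ⟨
    (G + U) * P ∸ G * P          ≡⟨ cong (_∸ G * P) (*-distribʳ-+ P G U) ⟩
    G * P + U * P ∸ G * P        ≡⟨ m+n∸m≡n (G * P) (U * P) ⟩
    U * P ∎
  P¹⁰≤X² : P ^ 10 ≤ X * X
  P¹⁰≤X² = begin
    P ^ 10         ≡⟨ ^-*-assoc 2 N 10 ⟩
    2 ^ (N * 10)   ≤⟨ ^-monoʳ-≤ 2 N*10≤P ⟩
    2 ^ 2 ^ N      ≡⟨ 2^2^N≡X² ⟩
    X * X ∎

proposition4p2 : ∃[ p ] ∃[ q ] (1 ≤ p × 1 ≤ q × ∃[ N ] ((n : ℕ) → N ≤ n →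
    ∃[ k ] Σ (Fin k → Sample n) (λ g →
      Injective _≡_ _≡_ g
      × ((i : Fin k) → IsSumset (SyesOf (g i)))
      × ((total n ∸ k) ^ q * 2 ^ (p * 2 ^ n) ≤ total n ^ q))))
proposition4p2 = 1 , 10 , s≤s z≤n , s≤s z≤n , 6 , λ where
  zero    ()
  (suc n) 6≤n → length (samples (suc n)) , lookup (samples (suc n))
              , lookup-injective (samples-unique (suc n))
              , (λ i → ∈-samples⇒isSumset (∈-lookup i))
              , failure-bound n (n*10≤2^n 6≤n)
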